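{- We have $$G^+_{12}(x)=\frac{x^2}{1-x^2}\qquad\text{and}\qquad G^-_{12}(x)=\frac{x^2}{1+x^2}.$$
   Context: A subsequence has type $\sigma$ if it has the same relative order as $\sigma$. For a permutation $\pi$, $I(3412;\pi)$ is the set of involutions of any length that avoid $3412$ and contain exactly one subsequence of type $\pi$. Then $G^+_\pi(x)=\sum_{\sigma\in I(3412;\pi)}x^{|\sigma|}$ and $G^-_\pi(x)=\sum_{\sigma\in I(3412;\pi)}\operatorname{sign}(\sigma)x^{|\sigma|}$, where $\operatorname{sign}(\sigma)=\pm1$ is the sign of $\sigma$. -}

module Defs where

open import Data.Bool using (Bool; true; false; _∧_; not; if_then_else_)
open import Data.Nat using (ℕ; zero; suc; _≡ᵇ_; _<ᵇ_; _∸_)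
open import Data.List using (List; []; _∷_; length; map; concatMap; upTo; filterᵇ; foldr)
open import Data.Bool.ListAction using (any; all)
open import Data.Integer using (ℤ; +_; -_; _*_; _+_)

-- Permutations of length n are represented as lists in one-line notation
-- over the alphabet {0,…,n-1}.

-- i-th entry (0-indexed) of a list, default 0
at : List ℕ → ℕ → ℕ
at []       _       = 0
at (x ∷ xs) zero    = x
at (x ∷ xs) (suc i) = at xs i

allWords : List ℕ → ℕ → List (List ℕ)
allWords A zero    = [] ∷ []
allWords A (suc k) = concatMap (λ a → map (a ∷_) (allWords A k)) A

distinctᵇ : List ℕ → Bool
distinctᵇ []       = true
distinctᵇ (x ∷ xs) = not (any (x ≡ᵇ_) xs) ∧ distinctᵇ xs

perms : ℕ → List (List ℕ)
perms n = filterᵇ distinctᵇ (allWords (upTo n) n)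

isInvolutionᵇ : List ℕ → Bool
isInvolutionᵇ σ = all (λ i → at σ (at σ i) ≡ᵇ i) (upTo (length σ))

-- all subsequences (chosen by positions; entries keep their order)
subseqs : List ℕ → List (List ℕ)
subseqs []       = [] ∷ []
subseqs (x ∷ xs) = subseqs xs Data.List.++ map (x ∷_) (subseqs xs)

sameTypeᵇ : List ℕ → List ℕ → Bool
sameTypeᵇ π τ =
  (length π ≡ᵇ length τ) ∧
  all (λ i → all (λ j → (at π i <ᵇ at π j) ≡B (at τ i <ᵇ at τ j)) (upTo (length π))) (upTo (length π))
  where
  _≡B_ : Bool → Bool → Bool
  true  ≡B b = b
  false ≡B b = not b

occ : List ℕ → List ℕ → ℕ
occ π σ = length (filterᵇ (sameTypeᵇ π) (subseqs σ))

-- sign of σ = (-1)^(number of inversions); inversions = occurrences of 21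
sign : List ℕ → ℤ
sign σ = signPow (occ (1 ∷ 0 ∷ []) σ)
  where
  signPow : ℕ → ℤ
  signPow zero    = + 1
  signPow (suc k) = - signPow k

-- membership in I(3412; π), restricted to length n
inIᵇ : List ℕ → List ℕ → Bool
inIᵇ π σ = isInvolutionᵇ σ ∧ (occ (2 ∷ 3 ∷ 0 ∷ 1 ∷ []) σ ≡ᵇ 0) ∧ (occ π σ ≡ᵇ 1)

I-len : List ℕ → ℕ → List (List ℕ)
I-len π n = filterᵇ (inIᵇ π) (perms n)

sumℤ : List ℤ → ℤ
sumℤ = foldr _+_ (+ 0)

FPS : Set
FPS = ℕ → ℤ

_⊛_ : FPS → FPS → FPS
(f ⊛ g) n = sumℤ (map (λ k → f k * g (n ∸ k)) (upTo (suc n)))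

Gplus : List ℕ → FPS
Gplus π n = + length (I-len π n)

Gminus : List ℕ → FPS
Gminus π n = sumℤ (map sign (I-len π n))

x² : FPS
x² 2 = + 1
x² _ = + 0

oneMinusX² : FPS
oneMinusX² 0 = + 1
oneMinusX² 2 = - (+ 1)
oneMinusX² _ = + 0

onePlusX² : FPS
onePlusX² 0 = + 1
onePlusX² 2 = + 1
onePlusX² _ = + 0

-- A permutation with exactly one occurrence of 12 has exactly one non-inversion. Such a
-- permutation of length m + j + 2 is the decreasing one with the values m, m + 1 put in
-- increasing order at positions j, j + 1. It avoids 3412, which has two non-inversions, and it
-- is an involution exactly when m = j. So I(3412; 12) holds one permutation of each even length
-- 2m + 2 and none of odd length; having C(2m + 2, 2) − 1 inversions, that permutation has sign
-- (−1)^m. These are the coefficients of x²/(1 − x²) and x²/(1 + x²).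

module Submission where

open import Defs
open import Data.Nat using (ℕ)
open import Data.List using (List; []; _∷_)
open import Data.Product using (_×_)
open import Relation.Binary.PropositionalEquality using (_≡_)

open import Data.Bool using (Bool; true; false; T; not; _∧_; if_then_else_)
open import Data.Bool.ListAction using (all; any)
open import Data.Bool.Properties using (T-∧; T-≡; T?)
open import Data.Empty using (⊥-elim)
open import Data.Integer using (ℤ; 0ℤ; 1ℤ; -_)
import Data.Integer as ℤ
import Data.Integer.Properties as ℤ
open import Data.List using (length; map; filterᵇ; _++_; upTo; downFrom; concatMap; cartesianProductWith)
open import Data.List.Membership.Propositional using (_∈_; _∉_)
open import Data.List.Membership.Propositional.Properties
  using ( ∈-++⁻; ∈-map⁻; ∈-filter⁺; ∈-filter⁻; ∈-upTo⁺; ∈-upTo⁻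
        ; ∈-cartesianProductWith⁺; ∈-cartesianProductWith⁻)
open import Data.List.Properties
  using (filter-++; length-++; filter-none; filter-accept; length-downFrom; ∷-injective; upTo-∷ʳ; map-++)
open import Data.List.Relation.Binary.Sublist.Propositional using (_⊆_; []; _∷_; _∷ʳ_)
import Data.List.Relation.Binary.Sublist.Propositional.Properties as Sublist
open import Data.List.Relation.Unary.All as All using (All; []; _∷_)
open import Data.List.Relation.Unary.All.Properties
  using (all⁺; all⁻; applyUpTo⁺₁; applyUpTo⁻; applyDownFrom⁺₁)
open import Data.List.Relation.Unary.AllPairs using (AllPairs; []; _∷_)
open import Data.List.Relation.Unary.Any using (here)
open import Data.List.Relation.Unary.Unique.Propositional using (Unique)
open import Data.List.Relation.Unary.Unique.Propositional.Properties
  using (downFrom⁺; upTo⁺; filter⁺; cartesianProductWith⁺)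
open import Data.Nat
  using (suc; zero; _+_; _*_; _∸_; _<_; _≤_; _>_; z≤n; s≤s; _<ᵇ_; _≡ᵇ_; ⌊_/2⌋
        ; compare; less; equal; greater)
open import Data.Nat.Properties
open import Algebra.Properties.CommutativeSemigroup +-commutativeSemigroup using (interchange)
open import Data.Product using (_,_; ∃₂; ∃-syntax)
open import Data.Sum using (inj₁; inj₂)
open import Function using (_∘_; flip; _⇔_; mk⇔; Equivalence)
open import Relation.Binary using (tri<; tri≈; tri>)
open import Relation.Binary.PropositionalEquality
  using (_≢_; refl; sym; trans; cong; cong₂; subst; module ≡-Reasoning)
open import Relation.Nullary using (¬_)

private variable
  A : Set

<ᵇ-irrefl : ∀ n → (n <ᵇ n) ≡ false
<ᵇ-irrefl zero    = refl
<ᵇ-irrefl (suc n) = <ᵇ-irrefl n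

<⇒<ᵇ≡true : ∀ {m n} → m < n → (m <ᵇ n) ≡ true
<⇒<ᵇ≡true = Equivalence.to T-≡ ∘ <⇒<ᵇ

≥⇒<ᵇ≡false : ∀ {m n} → n ≤ m → (m <ᵇ n) ≡ false
≥⇒<ᵇ≡false {n = zero}          _       = refl
≥⇒<ᵇ≡false {suc m} {n = suc n} (s≤s p) = ≥⇒<ᵇ≡false p

<ᵇ-complement : ∀ {x y} → x ≢ y → (x <ᵇ y) ≡ not (y <ᵇ x)
<ᵇ-complement {x} {y} x≢y with <-cmp x y
... | tri< x<y _ _ rewrite <⇒<ᵇ≡true x<y | ≥⇒<ᵇ≡false (<⇒≤ x<y) = refl
... | tri≈ _ x≡y _ = ⊥-elim (x≢y x≡y)
... | tri> _ _ y<x rewrite <⇒<ᵇ≡true y<x | ≥⇒<ᵇ≡false (<⇒≤ y<x) = refl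

T-not-any⇒All≢ : ∀ {x} xs → T (not (any (x ≡ᵇ_) xs)) → All (x ≢_) xs
T-not-any⇒All≢     []       _ = []
T-not-any⇒All≢ {x} (y ∷ ys) h with x ≡ᵇ y in x≡ᵇy
... | false = (λ x≡y → subst T x≡ᵇy (≡⇒≡ᵇ x y x≡y)) ∷ T-not-any⇒All≢ ys h

All≢⇒T-not-any : ∀ {x} xs → All (x ≢_) xs → T (not (any (x ≡ᵇ_) xs))
All≢⇒T-not-any     []       []           = _
All≢⇒T-not-any {x} (y ∷ ys) (x≢y ∷ x≢ys) with x ≡ᵇ y in x≡ᵇy
... | true  = ⊥-elim (x≢y (≡ᵇ⇒≡ x y (subst T (sym x≡ᵇy) _)))
... | false = All≢⇒T-not-any ys x≢ys

distinctᵇ⇒Unique : ∀ w → T (distinctᵇ w) → Unique w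
distinctᵇ⇒Unique []       _ = []
distinctᵇ⇒Unique (x ∷ xs) h with x∉xs , distinct ← Equivalence.to (T-∧ {not (any (x ≡ᵇ_) xs)}) h
  = T-not-any⇒All≢ xs x∉xs ∷ distinctᵇ⇒Unique xs distinct

Unique⇒distinctᵇ : ∀ {w} → Unique w → T (distinctᵇ w)
Unique⇒distinctᵇ []          = _
Unique⇒distinctᵇ (x≢xs ∷ u) = Equivalence.from T-∧ (All≢⇒T-not-any _ x≢xs , Unique⇒distinctᵇ u)

m+m-injective : ∀ {m n} → m + m ≡ n + n → m ≡ n
m+m-injective {m} {n} eq = trans (n≡⌊n+n/2⌋ m) (trans (cong ⌊_/2⌋ eq) (sym (n≡⌊n+n/2⌋ n)))

odd≢2+even : ∀ m n → suc (m + m) ≢ suc (suc (n + n))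
odd≢2+even m n eq = even≢odd m n (begin
  2 * m          ≡⟨ cong (m +_) (+-identityʳ m) ⟩
  m + m          ≡⟨ suc-injective eq ⟩
  suc (n + n)    ≡⟨ cong (suc ∘ (n +_)) (+-identityʳ n) ⟨
  suc (2 * n)    ∎)
  where open ≡-Reasoning

data EvenOrOdd : ℕ → Set where
  even : ∀ m → EvenOrOdd (m + m)
  odd  : ∀ m → EvenOrOdd (suc (m + m))

evenOrOdd : ∀ n → EvenOrOdd n
evenOrOdd zero = even 0
evenOrOdd (suc n) with evenOrOdd n
... | even m = odd m
... | odd m  = subst EvenOrOdd (cong suc (+-suc m m)) (even (suc m))

unique-singleton : ∀ {x : A} {xs} → Unique xs → All (_≡ x) xs → x ∈ xs → xs ≡ x ∷ []
unique-singleton []                []                ()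
unique-singleton _                 (refl ∷ [])       _ = refl
unique-singleton ((y≢z ∷ _) ∷ _) (refl ∷ refl ∷ _) _ = ⊥-elim (y≢z refl)

no-member⇒[] : ∀ {xs : List A} → (∀ {x} → x ∉ xs) → xs ≡ []
no-member⇒[] {xs = []}    _   = refl
no-member⇒[] {xs = x ∷ _} ∉xs = ⊥-elim (∉xs (here refl))

countᵇ : (A → Bool) → List A → ℕ
countᵇ p = length ∘ filterᵇ p

module _ (p : A → Bool) where

  countᵇ-++ : ∀ xs ys → countᵇ p (xs ++ ys) ≡ countᵇ p xs + countᵇ p ys
  countᵇ-++ xs ys = trans (cong length (filter-++ (T? ∘ p) xs ys)) (length-++ (filterᵇ p xs))

  countᵇ-map : ∀ {B : Set} (f : B → A) xs → countᵇ p (map f xs) ≡ countᵇ (p ∘ f) xs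
  countᵇ-map f []       = refl
  countᵇ-map f (x ∷ xs) with p (f x)
  ... | true  = cong suc (countᵇ-map f xs)
  ... | false = countᵇ-map f xs

  countᵇ-accept : ∀ {x xs} → T (p x) → countᵇ p (x ∷ xs) ≡ suc (countᵇ p xs)
  countᵇ-accept = cong length ∘ filter-accept (T? ∘ p)

  countᵇ-none : ∀ {xs} → All (λ x → ¬ T (p x)) xs → countᵇ p xs ≡ 0
  countᵇ-none = cong length ∘ filter-none (T? ∘ p)

  countᵇ≡0⇒none : ∀ xs → countᵇ p xs ≡ 0 → All (λ x → ¬ T (p x)) xs
  countᵇ≡0⇒none []       _    = []
  countᵇ≡0⇒none (x ∷ xs) none with p x in px
  ... | false = subst T px ∷ countᵇ≡0⇒none xs none

  countᵇ-mono-⊆ : ∀ {xs ys} → xs ⊆ ys → countᵇ p xs ≤ countᵇ p ys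
  countᵇ-mono-⊆ = Sublist.length-mono-≤ ∘ Sublist.filter⁺ (T? ∘ p) (T? ∘ p) (λ { refl px → px })

countᵇ-cong : ∀ {p q : A → Bool} → (∀ x → p x ≡ q x) → ∀ xs → countᵇ p xs ≡ countᵇ q xs
countᵇ-cong p≗q []       = refl
countᵇ-cong {p = p} {q} p≗q (x ∷ xs) with p x | q x | p≗q x
... | true  | .true  | refl = cong suc (countᵇ-cong p≗q xs)
... | false | .false | refl = countᵇ-cong p≗q xs

countᵇ-complement : ∀ {p q : A → Bool} xs → All (λ x → p x ≡ not (q x)) xs →
                    countᵇ p xs + countᵇ q xs ≡ length xs
countᵇ-complement []       [] = refl
countᵇ-complement {p = p} {q} (x ∷ xs) (px≡¬qx ∷ rest) with p x | q x | px≡¬qx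
... | false | true  | refl = trans (+-suc _ _) (cong suc (countᵇ-complement xs rest))
... | true  | false | refl = cong suc (countᵇ-complement xs rest)

-- Occurrences of 12, 21 and 3412

pairsᵇ : (ℕ → ℕ → Bool) → List ℕ → ℕ
pairsᵇ R []       = 0
pairsᵇ R (x ∷ xs) = countᵇ (R x) xs + pairsᵇ R xs

ascents : List ℕ → ℕ
ascents = pairsᵇ _<ᵇ_

inversions : List ℕ → ℕ
inversions = pairsᵇ (flip _<ᵇ_)

pairsᵇ-mono-⊆ : ∀ R {xs ys} → xs ⊆ ys → pairsᵇ R xs ≤ pairsᵇ R ys
pairsᵇ-mono-⊆ R []           = z≤n
pairsᵇ-mono-⊆ R (y ∷ʳ xs⊆)   = ≤-trans (pairsᵇ-mono-⊆ R xs⊆) (m≤n+m _ _)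
pairsᵇ-mono-⊆ R (refl ∷ xs⊆) = +-mono-≤ (countᵇ-mono-⊆ _ xs⊆) (pairsᵇ-mono-⊆ R xs⊆)

∈-subseqs⁻ : ∀ {τ} w → τ ∈ subseqs w → τ ⊆ w
∈-subseqs⁻ []       (here refl) = []
∈-subseqs⁻ (x ∷ xs) τ∈ with ∈-++⁻ (subseqs xs) τ∈
... | inj₁ τ∈xs = x ∷ʳ ∈-subseqs⁻ xs τ∈xs
... | inj₂ τ∈x∷xs with ∈-map⁻ (x ∷_) τ∈x∷xs
...   | σ , σ∈xs , refl = refl ∷ ∈-subseqs⁻ xs σ∈xs

countᵇ-subseqs-∷ : ∀ (p : List ℕ → Bool) x xs →
  countᵇ p (subseqs (x ∷ xs)) ≡ countᵇ p (subseqs xs) + countᵇ (p ∘ (x ∷_)) (subseqs xs)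
countᵇ-subseqs-∷ p x xs =
  trans (countᵇ-++ p (subseqs xs) _) (cong (countᵇ p (subseqs xs) +_) (countᵇ-map p (x ∷_) (subseqs xs)))

countᵇ-subseqs-nil : ∀ (p : List ℕ → Bool) → (∀ x τ → p (x ∷ τ) ≡ false) →
                     ∀ w → countᵇ p (subseqs w) ≡ countᵇ p ([] ∷ [])
countᵇ-subseqs-nil p p∷≡false []       = refl
countᵇ-subseqs-nil p p∷≡false (x ∷ xs) = begin
  countᵇ p (subseqs (x ∷ xs))
    ≡⟨ countᵇ-subseqs-∷ p x xs ⟩
  countᵇ p (subseqs xs) + countᵇ (p ∘ (x ∷_)) (subseqs xs)
    ≡⟨ cong₂ _+_ (countᵇ-subseqs-nil p p∷≡false xs)
                 (countᵇ-none _ (All.universal (λ τ → subst T (p∷≡false x τ)) (subseqs xs))) ⟩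
  countᵇ p ([] ∷ []) + 0
    ≡⟨ +-identityʳ _ ⟩
  countᵇ p ([] ∷ []) ∎
  where open ≡-Reasoning

singletonWith : (ℕ → Bool) → List ℕ → Bool
singletonWith q (y ∷ []) = q y
singletonWith q _        = false

pairWith : (ℕ → ℕ → Bool) → List ℕ → Bool
pairWith R []      = false
pairWith R (x ∷ τ) = singletonWith (R x) τ

countᵇ-singletonWith-subseqs : ∀ q w → countᵇ (singletonWith q) (subseqs w) ≡ countᵇ q w
countᵇ-singletonWith-subseqs q []       = refl
countᵇ-singletonWith-subseqs q (y ∷ ys)
  rewrite countᵇ-subseqs-∷ (singletonWith q) y ys
        | countᵇ-singletonWith-subseqs q ys
        | countᵇ-subseqs-nil (singletonWith q ∘ (y ∷_)) (λ _ _ → refl) ys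
  with q y
... | true  = +-comm _ 1
... | false = +-identityʳ _

countᵇ-pairWith-subseqs : ∀ R w → countᵇ (pairWith R) (subseqs w) ≡ pairsᵇ R w
countᵇ-pairWith-subseqs R []       = refl
countᵇ-pairWith-subseqs R (x ∷ xs) = begin
  countᵇ (pairWith R) (subseqs (x ∷ xs))
    ≡⟨ countᵇ-subseqs-∷ (pairWith R) x xs ⟩
  countᵇ (pairWith R) (subseqs xs) + countᵇ (singletonWith (R x)) (subseqs xs)
    ≡⟨ cong₂ _+_ (countᵇ-pairWith-subseqs R xs) (countᵇ-singletonWith-subseqs (R x) xs) ⟩
  pairsᵇ R xs + countᵇ (R x) xs
    ≡⟨ +-comm (pairsᵇ R xs) _ ⟩
  pairsᵇ R (x ∷ xs) ∎
  where open ≡-Reasoning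

π₁₂ π₂₁ π₃₄₁₂ : List ℕ
π₁₂   = 0 ∷ 1 ∷ []
π₂₁   = 1 ∷ 0 ∷ []
π₃₄₁₂ = 2 ∷ 3 ∷ 0 ∷ 1 ∷ []

sameType-12 : ∀ τ → sameTypeᵇ π₁₂ τ ≡ pairWith _<ᵇ_ τ
sameType-12 []              = refl
sameType-12 (x ∷ [])        = refl
sameType-12 (x ∷ y ∷ _ ∷ _) = refl
sameType-12 (x ∷ y ∷ []) rewrite <ᵇ-irrefl x | <ᵇ-irrefl y with <-cmp x y
... | tri< x<y _ _ rewrite <⇒<ᵇ≡true x<y | ≥⇒<ᵇ≡false (<⇒≤ x<y) = refl
... | tri≈ _ refl _ rewrite <ᵇ-irrefl x = refl
... | tri> _ _ y<x rewrite ≥⇒<ᵇ≡false (<⇒≤ y<x) = refl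

sameType-21 : ∀ τ → sameTypeᵇ π₂₁ τ ≡ pairWith (flip _<ᵇ_) τ
sameType-21 []              = refl
sameType-21 (x ∷ [])        = refl
sameType-21 (x ∷ y ∷ _ ∷ _) = refl
sameType-21 (x ∷ y ∷ []) rewrite <ᵇ-irrefl x | <ᵇ-irrefl y with <-cmp x y
... | tri< x<y _ _ rewrite <⇒<ᵇ≡true x<y | ≥⇒<ᵇ≡false (<⇒≤ x<y) = refl
... | tri≈ _ refl _ rewrite <ᵇ-irrefl x = refl
... | tri> _ _ y<x rewrite ≥⇒<ᵇ≡false (<⇒≤ y<x) | <⇒<ᵇ≡true y<x = refl

occ-12 : ∀ w → occ π₁₂ w ≡ ascents w
occ-12 w = trans (countᵇ-cong sameType-12 (subseqs w)) (countᵇ-pairWith-subseqs _<ᵇ_ w)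

occ-21 : ∀ w → occ π₂₁ w ≡ inversions w
occ-21 w = trans (countᵇ-cong sameType-21 (subseqs w)) (countᵇ-pairWith-subseqs (flip _<ᵇ_) w)

2≤ascents : ∀ {a b c d} → T (a <ᵇ b) → T (c <ᵇ d) → 2 ≤ ascents (a ∷ b ∷ c ∷ d ∷ [])
2≤ascents {a} {b} {c} {d} a<b c<d rewrite Equivalence.to T-≡ a<b | Equivalence.to T-≡ c<d =
  s≤s (≤-trans (m≤n+m 1 b↗) (m≤n+m (b↗ + 1) (countᵇ (a <ᵇ_) (c ∷ d ∷ []))))
  where b↗ = countᵇ (b <ᵇ_) (c ∷ d ∷ [])

-- For a concrete π this is, up to conversion, the (i, j) conjunct of sameTypeᵇ π τ, whose
-- own comparison function is local to Defs.
sameOrderᵇ : List ℕ → List ℕ → ℕ → ℕ → Bool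
sameOrderᵇ π τ i j = if at π i <ᵇ at π j then at τ i <ᵇ at τ j else not (at τ i <ᵇ at τ j)

3412⇒2≤ascents : ∀ τ → T (sameTypeᵇ π₃₄₁₂ τ) → 2 ≤ ascents τ
3412⇒2≤ascents τ@(a ∷ b ∷ c ∷ d ∷ []) τ~3412
  with r₀ ∷ _ ∷ r₂ ∷ _    ← all⁺ (λ i → all (sameOrderᵇ π₃₄₁₂ τ i) (upTo 4)) (upTo 4) τ~3412
  with _ ∷ a<b ∷ _         ← all⁺ (sameOrderᵇ π₃₄₁₂ τ 0) (upTo 4) r₀
  with _ ∷ _ ∷ _ ∷ c<d ∷ _ ← all⁺ (sameOrderᵇ π₃₄₁₂ τ 2) (upTo 4) r₂
  = 2≤ascents {a} {b} {c} {d} a<b c<d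

occ-3412≡0 : ∀ w → ascents w ≤ 1 → occ π₃₄₁₂ w ≡ 0
occ-3412≡0 w ascents≤1 = countᵇ-none _ (All.tabulate λ {τ} τ∈ τ~3412 →
  1+n≰n (≤-trans (3412⇒2≤ascents τ τ~3412) (≤-trans (pairsᵇ-mono-⊆ _<ᵇ_ (∈-subseqs⁻ w τ∈)) ascents≤1)))

-- Permutations with a single ascent

downFrom-< : ∀ n → All (_< n) (downFrom n)
downFrom-< n = applyDownFrom⁺₁ _ n (λ i<n → i<n)

countᵇ-above≡0 : ∀ {x xs} → All (_< x) xs → countᵇ (x <ᵇ_) xs ≡ 0
countᵇ-above≡0 = countᵇ-none _ ∘ All.map (λ y<x x<y → <-asym y<x (<ᵇ⇒< _ _ x<y))

countᵇ-above≡0⇒below : ∀ {x xs} → All (x ≢_) xs → countᵇ (x <ᵇ_) xs ≡ 0 → All (_< x) xs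
countᵇ-above≡0⇒below {xs = xs} x≢xs none = All.zipWith
  (λ (x≢y , x≮y) → ≤∧≢⇒< (≮⇒≥ (x≮y ∘ <⇒<ᵇ)) (x≢y ∘ sym))
  (x≢xs , countᵇ≡0⇒none _ xs none)

ascents-∷-max : ∀ {x xs} → All (_< x) xs → ascents (x ∷ xs) ≡ ascents xs
ascents-∷-max xs<x = cong (_+ _) (countᵇ-above≡0 xs<x)

ascents-downFrom : ∀ n → ascents (downFrom n) ≡ 0
ascents-downFrom zero    = refl
ascents-downFrom (suc n) = trans (ascents-∷-max (downFrom-< n)) (ascents-downFrom n)

ascents≡0⇒decreasing : ∀ {xs} → Unique xs → ascents xs ≡ 0 → AllPairs _>_ xs
ascents≡0⇒decreasing []         _    = []
ascents≡0⇒decreasing (x≢xs ∷ u) none =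
  countᵇ-above≡0⇒below x≢xs (m+n≡0⇒m≡0 _ none) ∷ ascents≡0⇒decreasing u (m+n≡0⇒n≡0 _ none)

decreasing-length≤ : ∀ {n xs} → AllPairs _>_ xs → All (_< n) xs → length xs ≤ n
decreasing-length≤ []           []        = z≤n
decreasing-length≤ (x>xs ∷ dec) (x<n ∷ _) = ≤-trans (s≤s (decreasing-length≤ dec x>xs)) x<n

decreasing⇒downFrom : ∀ {xs} → AllPairs _>_ xs → All (_< length xs) xs → xs ≡ downFrom (length xs)
decreasing⇒downFrom []                     []           = refl
decreasing⇒downFrom {x ∷ xs} (x>xs ∷ dec) (x≤|xs| ∷ _) =
  cong₂ _∷_ x≡|xs| (decreasing⇒downFrom dec (subst (λ n → All (_< n) xs) x≡|xs| x>xs))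
  where
  x≡|xs| : x ≡ length xs
  x≡|xs| = ≤-antisym (≤-pred x≤|xs|) (decreasing-length≤ dec x>xs)

-- The decreasing arrangement of 0, …, j + m + 1 with the values m, m + 1 swapped into
-- increasing order; they sit at positions j, j + 1.
oneAscent : ℕ → ℕ → List ℕ
oneAscent m zero    = m ∷ suc m ∷ downFrom m
oneAscent m (suc j) = suc (suc (j + m)) ∷ oneAscent m j

length-oneAscent : ∀ m j → length (oneAscent m j) ≡ suc (suc (j + m))
length-oneAscent m zero    = cong (suc ∘ suc) (length-downFrom m)
length-oneAscent m (suc j) = cong suc (length-oneAscent m j)

oneAscent-< : ∀ m j → All (_< suc (suc (j + m))) (oneAscent m j)
oneAscent-< m zero    =
  m<n⇒m<1+n (n<1+n m) ∷ n<1+n (suc m) ∷ All.map (m<n⇒m<1+n ∘ m<n⇒m<1+n) (downFrom-< m)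
oneAscent-< m (suc j) = n<1+n _ ∷ All.map m<n⇒m<1+n (oneAscent-< m j)

oneAscent-max : ∀ {x} m j → All (_< x) (oneAscent m j) → suc (j + m) < x
oneAscent-max m zero    (_ ∷ 1+m<x ∷ _) = 1+m<x
oneAscent-max m (suc j) (max<x ∷ _)     = max<x

Unique-oneAscent : ∀ m j → Unique (oneAscent m j)
Unique-oneAscent m zero    = (<⇒≢ (n<1+n m) ∷ All.map >⇒≢ (downFrom-< m))
                           ∷ All.map (>⇒≢ ∘ m<n⇒m<1+n) (downFrom-< m)
                           ∷ downFrom⁺ m
Unique-oneAscent m (suc j) = All.map >⇒≢ (oneAscent-< m j) ∷ Unique-oneAscent m j

ascents-oneAscent : ∀ m j → ascents (oneAscent m j) ≡ 1
ascents-oneAscent m zero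
  rewrite <⇒<ᵇ≡true (n<1+n m)
        | countᵇ-above≡0 (downFrom-< m)
        | ascents-∷-max (All.map m<n⇒m<1+n (downFrom-< m))
        | ascents-downFrom m = refl
ascents-oneAscent m (suc j) = trans (ascents-∷-max (oneAscent-< m j)) (ascents-oneAscent m j)

ascent-at-head⇒oneAscent : ∀ {x y rest} → Unique (x ∷ y ∷ rest) →
                           All (_< suc (suc (length rest))) (x ∷ y ∷ rest) →
                           AllPairs _>_ (y ∷ rest) → countᵇ (x <ᵇ_) (y ∷ rest) ≡ 1 →
                           x ∷ y ∷ rest ≡ oneAscent (length rest) 0
ascent-at-head⇒oneAscent {x} {y} {rest} ((x≢y ∷ x≢rest) ∷ _) (_ ∷ y≤1+k ∷ _) (y>rest ∷ dec) once
  with <-cmp x y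
... | tri< x<y _ _ = cong₂ _∷_ x≡k (cong₂ _∷_ y≡1+k rest≡downFrom)
  where
  rest<x : All (_< x) rest
  rest<x = countᵇ-above≡0⇒below x≢rest
    (suc-injective (trans (sym (countᵇ-accept (x <ᵇ_) {y} {rest} (<⇒<ᵇ x<y))) once))
  x≡k : x ≡ length rest
  x≡k = ≤-antisym (≤-pred (<-≤-trans x<y (≤-pred y≤1+k))) (decreasing-length≤ dec rest<x)
  y≡1+k : y ≡ suc (length rest)
  y≡1+k = ≤-antisym (≤-pred y≤1+k) (subst (_< y) x≡k x<y)
  rest≡downFrom : rest ≡ downFrom (length rest)
  rest≡downFrom = decreasing⇒downFrom dec (subst (λ n → All (_< n) rest) x≡k rest<x)
... | tri≈ _ x≡y _ = ⊥-elim (x≢y x≡y)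
... | tri> _ _ y<x =
  ⊥-elim (0≢1+n (trans (sym (countᵇ-above≡0 (y<x ∷ All.map (λ r<y → <-trans r<y y<x) y>rest))) once))

max∷oneAscent : ∀ {x xs} m j → xs ≡ oneAscent m j → All (_< x) xs → x < suc (length xs) →
                x ∷ xs ≡ oneAscent m (suc j)
max∷oneAscent m j refl xs<x x≤|xs| = cong (_∷ oneAscent m j)
  (≤-antisym (≤-pred (subst (λ n → _ < suc n) (length-oneAscent m j) x≤|xs|)) (oneAscent-max m j xs<x))

oneAscent-complete : ∀ {w} → Unique w → All (_< length w) w → ascents w ≡ 1 →
                     ∃₂ λ m j → w ≡ oneAscent m j
oneAscent-complete {[]}    _ _ ()
oneAscent-complete {_ ∷ []} _ _ ()
oneAscent-complete {x ∷ y ∷ rest} u@(x≢xs ∷ u′) w<n@(x≤|xs| ∷ _) once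
  with countᵇ (_<ᵇ_ x) (y ∷ rest) in above
... | zero
  with xs<x ← countᵇ-above≡0⇒below x≢xs above
  with m , j , xs≡ ← oneAscent-complete u′ (All.map (λ y<x → <-≤-trans y<x (≤-pred x≤|xs|)) xs<x) once
  = m , suc j , max∷oneAscent m j xs≡ xs<x x≤|xs|
... | suc zero =
  length rest , 0 , ascent-at-head⇒oneAscent u w<n (ascents≡0⇒decreasing u′ (suc-injective once)) above
... | suc (suc _) with () ← once

-- Involutions

IsInvolution : List ℕ → Set
IsInvolution σ = ∀ {i} → i < length σ → at σ (at σ i) ≡ i

isInvolutionᵇ⁻ : ∀ σ → T (isInvolutionᵇ σ) → IsInvolution σ
isInvolutionᵇ⁻ σ h i<n =
  ≡ᵇ⇒≡ _ _ (applyUpTo⁻ _ (length σ) (all⁺ (λ i → at σ (at σ i) ≡ᵇ i) (upTo (length σ)) h) i<n)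

isInvolutionᵇ⁺ : ∀ σ → IsInvolution σ → T (isInvolutionᵇ σ)
isInvolutionᵇ⁺ σ inv =
  all⁻ (λ i → at σ (at σ i) ≡ᵇ i) (applyUpTo⁺₁ _ (length σ) (λ i<n → ≡⇒≡ᵇ _ _ (inv i<n)))

at-downFrom : ∀ t r → at (downFrom (suc (t + r))) t ≡ r
at-downFrom zero    r = refl
at-downFrom (suc t) r = at-downFrom t r

at-oneAscent-before : ∀ m i t → at (oneAscent m (suc (i + t))) i ≡ suc (suc (t + m))
at-oneAscent-before m zero    t = refl
at-oneAscent-before m (suc i) t = at-oneAscent-before m i t

at-oneAscent-j : ∀ m j → at (oneAscent m j) j ≡ m
at-oneAscent-j m zero    = refl
at-oneAscent-j m (suc j) = at-oneAscent-j m j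

at-oneAscent-1+j : ∀ m j → at (oneAscent m j) (suc j) ≡ suc m
at-oneAscent-1+j m zero    = refl
at-oneAscent-1+j m (suc j) = at-oneAscent-1+j m j

at-oneAscent-after : ∀ m j t → at (oneAscent m j) (suc (suc (j + t))) ≡ at (downFrom m) t
at-oneAscent-after m zero    t = refl
at-oneAscent-after m (suc j) t = at-oneAscent-after m j t

1+j<|oneAscent| : ∀ m j → suc j < length (oneAscent m j)
1+j<|oneAscent| m j = subst (suc j <_) (sym (length-oneAscent m j)) (s≤s (s≤s (m≤m+n j m)))

oneAscent-involutive⇒ : ∀ m j → IsInvolution (oneAscent m j) → m ≡ j
oneAscent-involutive⇒ m j inv with compare m j
... | less m k = ⊥-elim (1+n≢n (begin
  suc (suc (m + k))  ≡⟨ cong (suc ∘ suc) (+-comm m k) ⟩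
  suc (suc (k + m))  ≡⟨ at-oneAscent-before m m k ⟨
  at σ m             ≡⟨ cong (at σ) (at-oneAscent-j m j) ⟨
  at σ (at σ j)      ≡⟨ inv (<-trans (n<1+n j) (1+j<|oneAscent| m j)) ⟩
  suc (m + k)        ∎))
  where σ = oneAscent m j
        open ≡-Reasoning
... | equal m = refl
... | greater j k = ⊥-elim (1+n≢n (sym (begin
  j                              ≡⟨ at-downFrom k j ⟨
  at (downFrom (suc (k + j))) k  ≡⟨ cong (λ n → at (downFrom (suc n)) k) (+-comm k j) ⟩
  at (downFrom m) k              ≡⟨ at-oneAscent-after m j k ⟨
  at σ (suc m)                   ≡⟨ cong (at σ) (at-oneAscent-1+j m j) ⟨
  at σ (at σ (suc j))            ≡⟨ inv (1+j<|oneAscent| m j) ⟩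
  suc j                          ∎)))
  where σ = oneAscent m j
        open ≡-Reasoning

oneAscent-mirror : ∀ i k → let m = suc (i + k); σ = oneAscent m m in
                   at σ i ≡ suc (suc (m + k)) × at σ (suc (suc (m + k))) ≡ i
oneAscent-mirror i k =
    trans (at-oneAscent-before m i k) (cong (suc ∘ suc) (+-comm k m))
  , trans (at-oneAscent-after m m k)
          (trans (cong (λ n → at (downFrom (suc n)) k) (+-comm i k)) (at-downFrom k i))
  where m = suc (i + k)

oneAscent-involutive : ∀ m → IsInvolution (oneAscent m m)
oneAscent-involutive m {i} i<n with compare i m
... | less i k
  with σi≡ , σσi≡ ← oneAscent-mirror i k = trans (cong (at (oneAscent m m)) σi≡) σσi≡
... | equal m = trans (cong (at (oneAscent m m)) (at-oneAscent-j m m)) (at-oneAscent-j m m)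
... | greater m zero rewrite +-identityʳ m =
  trans (cong (at (oneAscent m m)) (at-oneAscent-1+j m m)) (at-oneAscent-1+j m m)
-- i = m + r + 2 with r < m is the mirror of position s, where m = s + r + 1.
... | greater m (suc r) rewrite +-suc m r | length-oneAscent m m
  with s , refl ← m≤n⇒∃[o]m+o≡n (+-cancelˡ-< m r m (≤-pred (≤-pred i<n)))
  rewrite +-comm r s
  with σs≡ , σσs≡ ← oneAscent-mirror s r
  = trans (cong (at (oneAscent (suc (s + r)) (suc (s + r)))) σσs≡) σs≡

-- Signs

choose2 : ℕ → ℕ
choose2 zero    = 0
choose2 (suc n) = n + choose2 n

ascents+inversions : ∀ {w} → Unique w → ascents w + inversions w ≡ choose2 (length w)
ascents+inversions []                   = refl
ascents+inversions {x ∷ xs} (x≢xs ∷ u) = begin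
  (countᵇ (x <ᵇ_) xs + ascents xs) + (countᵇ (_<ᵇ x) xs + inversions xs)
    ≡⟨ interchange (countᵇ (x <ᵇ_) xs) (ascents xs) _ _ ⟩
  (countᵇ (x <ᵇ_) xs + countᵇ (_<ᵇ x) xs) + (ascents xs + inversions xs)
    ≡⟨ cong₂ _+_ (countᵇ-complement xs (All.map <ᵇ-complement x≢xs)) (ascents+inversions u) ⟩
  length xs + choose2 (length xs) ∎
  where open ≡-Reasoning

altSign : ℕ → ℤ
altSign zero    = 1ℤ
altSign (suc k) = - altSign k

altSign-unique : ∀ {f : ℕ → ℤ} → f 0 ≡ 1ℤ → (∀ k → f (suc k) ≡ - f k) → ∀ k → f k ≡ altSign k
altSign-unique f0 f+1 zero    = f0
altSign-unique f0 f+1 (suc k) = trans (f+1 k) (cong -_ (altSign-unique f0 f+1 k))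

-- The power of −1 in sign is local to Defs; once occ π₂₁ w is abstracted to a variable k, it is
-- the function f of altSign-unique, inferred from its value at k.
sign≡altSign : ∀ w → sign w ≡ altSign (inversions w)
sign≡altSign w = trans (by-recurrence w) (cong altSign (occ-21 w))
  where
  by-recurrence : ∀ w → sign w ≡ altSign (occ π₂₁ w)
  by-recurrence w with occ π₂₁ w | altSign-unique refl (λ _ → refl)
  ... | k | power≡altSign = power≡altSign k

altSign-2+ : ∀ k → altSign (suc (suc k)) ≡ altSign k
altSign-2+ k = ℤ.neg-involutive (altSign k)

altSign-double+ : ∀ q k → altSign (q + q + k) ≡ altSign k
altSign-double+ zero    k = refl
altSign-double+ (suc q) k rewrite +-suc q q = trans (altSign-2+ (q + q + k)) (altSign-double+ q k)

altSign-choose2 : ∀ m → altSign (choose2 (suc (suc (m + m)))) ≡ - altSign m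
altSign-choose2 zero    = refl
altSign-choose2 (suc m) rewrite +-suc m m = begin
  altSign (suc (suc (suc (m + m))) + (suc (suc (m + m)) + c))
    ≡⟨ cong -_ (altSign-2+ (m + m + (suc (suc (m + m)) + c))) ⟩
  - altSign (m + m + (suc (suc (m + m)) + c))
    ≡⟨ cong -_ (altSign-double+ m _) ⟩
  - altSign (suc (suc (m + m + c)))
    ≡⟨ cong -_ (altSign-2+ (m + m + c)) ⟩
  - altSign (m + m + c)
    ≡⟨ cong -_ (altSign-double+ m c) ⟩
  - altSign c
    ≡⟨ cong -_ (altSign-choose2 m) ⟩
  - altSign (suc m) ∎
  where open ≡-Reasoning
        c = choose2 (suc (suc (m + m)))

sign-oneAscent : ∀ m → sign (oneAscent m m) ≡ altSign m
sign-oneAscent m = begin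
  sign σ                                   ≡⟨ sign≡altSign σ ⟩
  altSign (inversions σ)                   ≡⟨ ℤ.neg-involutive _ ⟨
  - altSign (suc (inversions σ))           ≡⟨ cong (-_ ∘ altSign) 1+inversions ⟩
  - altSign (choose2 (suc (suc (m + m))))  ≡⟨ cong -_ (altSign-choose2 m) ⟩
  - - altSign m                            ≡⟨ ℤ.neg-involutive _ ⟩
  altSign m                                ∎
  where
  open ≡-Reasoning
  σ = oneAscent m m
  1+inversions : suc (inversions σ) ≡ choose2 (suc (suc (m + m)))
  1+inversions = begin
    1 + inversions σ             ≡⟨ cong (_+ inversions σ) (ascents-oneAscent m m) ⟨
    ascents σ + inversions σ     ≡⟨ ascents+inversions (Unique-oneAscent m m) ⟩
    choose2 (length σ)           ≡⟨ cong choose2 (length-oneAscent m m) ⟩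
    choose2 (suc (suc (m + m)))  ∎

-- The set I(3412; 12)

concatMap-∷≡cartesianProductWith : ∀ (B : List ℕ) (W : List (List ℕ)) →
  concatMap (λ b → map (b ∷_) W) B ≡ cartesianProductWith _∷_ B W
concatMap-∷≡cartesianProductWith []      W = refl
concatMap-∷≡cartesianProductWith (b ∷ B) W =
  cong (map (b ∷_) W ++_) (concatMap-∷≡cartesianProductWith B W)

Unique-allWords : ∀ {as} → Unique as → ∀ k → Unique (allWords as k)
Unique-allWords u zero         = [] ∷ []
Unique-allWords {as} u (suc k) = subst Unique (sym (concatMap-∷≡cartesianProductWith as (allWords as k)))
  (cartesianProductWith⁺ _∷_ ∷-injective u (Unique-allWords u k))

∈-allWords⁺ : ∀ {as w} → All (_∈ as) w → w ∈ allWords as (length w)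
∈-allWords⁺      []            = here refl
∈-allWords⁺ {as} (a∈as ∷ w⊆as) = subst (_ ∈_) (sym (concatMap-∷≡cartesianProductWith as _))
  (∈-cartesianProductWith⁺ _∷_ a∈as (∈-allWords⁺ w⊆as))

∈-allWords⁻ : ∀ {as} k {w} → w ∈ allWords as k → length w ≡ k × All (_∈ as) w
∈-allWords⁻ zero (here refl) = refl , []
∈-allWords⁻ {as} (suc k) w∈
  with a , τ , a∈as , τ∈ , refl ← ∈-cartesianProductWith⁻ _∷_ as (allWords as k)
                                     (subst (_ ∈_) (concatMap-∷≡cartesianProductWith as (allWords as k)) w∈)
  with |τ|≡k , τ⊆as ← ∈-allWords⁻ k τ∈
  = cong suc |τ|≡k , a∈as ∷ τ⊆as

inIᵇ⇔ : ∀ π w → T (inIᵇ π w) ⇔ (T (isInvolutionᵇ w) × occ π₃₄₁₂ w ≡ 0 × occ π w ≡ 1)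
inIᵇ⇔ π w = mk⇔
  (λ h → let inv , rest    = Equivalence.to (T-∧ {isInvolutionᵇ w}) h
             avoids , once = Equivalence.to (T-∧ {occ π₃₄₁₂ w ≡ᵇ 0}) rest
         in inv , ≡ᵇ⇒≡ _ _ avoids , ≡ᵇ⇒≡ _ _ once)
  (λ (inv , avoids , once) →
     Equivalence.from T-∧ (inv , Equivalence.from T-∧ (≡⇒≡ᵇ _ _ avoids , ≡⇒≡ᵇ _ _ once)))

Unique-I-len : ∀ π n → Unique (I-len π n)
Unique-I-len π n = filter⁺ (T? ∘ inIᵇ π) (filter⁺ (T? ∘ distinctᵇ) (Unique-allWords (upTo⁺ n) n))

∈-I₁₂⁻ : ∀ {n w} → w ∈ I-len π₁₂ n → ∃[ m ] n ≡ suc (suc (m + m)) × w ≡ oneAscent m m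
∈-I₁₂⁻ {n} {w} w∈
  with w∈perms , inI      ← ∈-filter⁻ (T? ∘ inIᵇ π₁₂) w∈
  with w∈words , distinct ← ∈-filter⁻ (T? ∘ distinctᵇ) w∈perms
  with refl , w⊆          ← ∈-allWords⁻ n w∈words
  with inv , _ , once     ← Equivalence.to (inIᵇ⇔ π₁₂ w) inI
  with m , j , refl       ← oneAscent-complete (distinctᵇ⇒Unique w distinct) (All.map ∈-upTo⁻ w⊆)
                                               (trans (sym (occ-12 w)) once)
  with refl               ← oneAscent-involutive⇒ m j (isInvolutionᵇ⁻ (oneAscent m j) inv)
  = m , length-oneAscent m m , refl

∈-I₁₂⁺ : ∀ m → oneAscent m m ∈ I-len π₁₂ (suc (suc (m + m)))
∈-I₁₂⁺ m = ∈-filter⁺ (T? ∘ inIᵇ π₁₂)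
  (∈-filter⁺ (T? ∘ distinctᵇ) σ∈words (Unique⇒distinctᵇ (Unique-oneAscent m m)))
  (Equivalence.from (inIᵇ⇔ π₁₂ σ)
    ( isInvolutionᵇ⁺ σ (oneAscent-involutive m)
    , occ-3412≡0 σ (≤-reflexive (ascents-oneAscent m m))
    , trans (occ-12 σ) (ascents-oneAscent m m)))
  where
  σ = oneAscent m m
  n = suc (suc (m + m))
  σ∈words : σ ∈ allWords (upTo n) n
  σ∈words = subst (λ k → σ ∈ allWords (upTo n) k) (length-oneAscent m m)
                  (∈-allWords⁺ (All.map ∈-upTo⁺ (oneAscent-< m m)))

I₁₂-even : ∀ m → I-len π₁₂ (suc (suc (m + m))) ≡ oneAscent m m ∷ []
I₁₂-even m =
  unique-singleton (Unique-I-len π₁₂ (suc (suc (m + m)))) (All.tabulate only-oneAscent) (∈-I₁₂⁺ m)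
  where
  only-oneAscent : ∀ {w} → w ∈ I-len π₁₂ (suc (suc (m + m))) → w ≡ oneAscent m m
  only-oneAscent w∈ with m′ , n≡ , refl ← ∈-I₁₂⁻ {suc (suc (m + m))} w∈ =
    cong (λ k → oneAscent k k) (sym (m+m-injective (suc-injective (suc-injective n≡))))

I₁₂-empty : ∀ n → (∀ m → n ≢ suc (suc (m + m))) → I-len π₁₂ n ≡ []
I₁₂-empty n n≢ = no-member⇒[] λ w∈ → let m , n≡ , _ = ∈-I₁₂⁻ w∈ in n≢ m n≡

-- Power series

sumℤ-∷ʳ : ∀ xs x → sumℤ (xs ++ x ∷ []) ≡ sumℤ xs ℤ.+ x
sumℤ-∷ʳ []       x = trans (ℤ.+-identityʳ x) (sym (ℤ.+-identityˡ x))
sumℤ-∷ʳ (y ∷ ys) x = trans (cong (λ s → y ℤ.+ s) (sumℤ-∷ʳ ys x)) (sym (ℤ.+-assoc y _ x))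

sumℤ-upTo-suc : ∀ (h : ℕ → ℤ) n → sumℤ (map h (upTo (suc n))) ≡ sumℤ (map h (upTo n)) ℤ.+ h n
sumℤ-upTo-suc h n = begin
  sumℤ (map h (upTo (suc n)))         ≡⟨ cong (sumℤ ∘ map h) (upTo-∷ʳ n) ⟨
  sumℤ (map h (upTo n ++ n ∷ []))     ≡⟨ cong sumℤ (map-++ h (upTo n) (n ∷ [])) ⟩
  sumℤ (map h (upTo n) ++ h n ∷ [])   ≡⟨ sumℤ-∷ʳ (map h (upTo n)) (h n) ⟩
  sumℤ (map h (upTo n)) ℤ.+ h n       ∎
  where open ≡-Reasoning

sumℤ-upTo-zero : ∀ (h : ℕ → ℤ) n → (∀ {i} → i < n → h i ≡ 0ℤ) → sumℤ (map h (upTo n)) ≡ 0ℤ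
sumℤ-upTo-zero h zero    _   = refl
sumℤ-upTo-zero h (suc n) h≡0 =
  trans (sumℤ-upTo-suc h n) (cong₂ ℤ._+_ (sumℤ-upTo-zero h n (h≡0 ∘ m<n⇒m<1+n)) (h≡0 (n<1+n n)))

⊛-quadratic : ∀ (f g : FPS) → (∀ {j} → 3 ≤ j → g j ≡ 0ℤ) → ∀ k →
  (f ⊛ g) (suc (suc k)) ≡ f k ℤ.* g 2 ℤ.+ f (suc k) ℤ.* g 1 ℤ.+ f (suc (suc k)) ℤ.* g 0
⊛-quadratic f g g-vanish k = begin
  sumℤ (map h (upTo (3 + k)))
    ≡⟨ sumℤ-upTo-suc h (2 + k) ⟩
  sumℤ (map h (upTo (2 + k))) ℤ.+ h (2 + k)
    ≡⟨ cong (λ s → s ℤ.+ h (2 + k)) (sumℤ-upTo-suc h (1 + k)) ⟩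
  sumℤ (map h (upTo (1 + k))) ℤ.+ h (1 + k) ℤ.+ h (2 + k)
    ≡⟨ cong (λ s → s ℤ.+ h (1 + k) ℤ.+ h (2 + k)) (sumℤ-upTo-suc h k) ⟩
  sumℤ (map h (upTo k)) ℤ.+ h k ℤ.+ h (1 + k) ℤ.+ h (2 + k)
    ≡⟨ cong (λ s → s ℤ.+ h k ℤ.+ h (1 + k) ℤ.+ h (2 + k)) (sumℤ-upTo-zero h k far) ⟩
  0ℤ ℤ.+ h k ℤ.+ h (1 + k) ℤ.+ h (2 + k)
    ≡⟨ cong (λ s → s ℤ.+ h (1 + k) ℤ.+ h (2 + k)) (ℤ.+-identityˡ (h k)) ⟩
  h k ℤ.+ h (1 + k) ℤ.+ h (2 + k)
    ≡⟨ cong₂ ℤ._+_ (cong₂ ℤ._+_ (term k (m+n∸n≡m 2 k)) (term (1 + k) (m+n∸n≡m 1 k)))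
                   (term (2 + k) (n∸n≡0 (2 + k))) ⟩
  f k ℤ.* g 2 ℤ.+ f (suc k) ℤ.* g 1 ℤ.+ f (suc (suc k)) ℤ.* g 0 ∎
  where
  open ≡-Reasoning
  h : ℕ → ℤ
  h i = f i ℤ.* g (2 + k ∸ i)
  term : ∀ i {d} → 2 + k ∸ i ≡ d → h i ≡ f i ℤ.* g d
  term i = cong (λ d → f i ℤ.* g d)
  far : ∀ {i} → i < k → h i ≡ 0ℤ
  far {i} i<k =
    trans (cong (λ z → f i ℤ.* z) (g-vanish (m+n≤o⇒m≤o∸n 3 (s≤s (s≤s i<k))))) (ℤ.*-zeroʳ (f i))

-- Here g = 1 + c x² with c = g 2, and f = Σₘ aₘ x^(2m+2).
⊛-even-series≡x² : ∀ (f g : FPS) (a : ℕ → ℤ) →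
  g 0 ≡ 1ℤ → g 1 ≡ 0ℤ → (∀ {j} → 3 ≤ j → g j ≡ 0ℤ) →
  (∀ n → (∀ m → n ≢ suc (suc (m + m))) → f n ≡ 0ℤ) → (∀ m → f (suc (suc (m + m))) ≡ a m) →
  a 0 ≡ 1ℤ → (∀ m → a m ℤ.* g 2 ℤ.+ a (suc m) ≡ 0ℤ) →
  ∀ n → (f ⊛ g) n ≡ x² n
⊛-even-series≡x² f g a g0≡1 g1≡0 g-vanish f-vanish f-even a0≡1 a-step = coefficient
  where
  f0≡0 : f 0 ≡ 0ℤ
  f0≡0 = f-vanish 0 (λ _ ())
  f-odd : ∀ m → f (suc (m + m)) ≡ 0ℤ
  f-odd m = f-vanish _ (odd≢2+even m)
  f-odd′ : ∀ m → f (suc (suc (suc (m + m)))) ≡ 0ℤ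
  f-odd′ m = subst (λ n → f (suc (suc n)) ≡ 0ℤ) (+-suc m m) (f-odd (suc m))
  near : ∀ k → EvenOrOdd k →
         f k ℤ.* g 2 ℤ.+ f (suc k) ℤ.* g 1 ℤ.+ f (suc (suc k)) ℤ.* g 0 ≡ x² (suc (suc k))
  near _ (even zero) rewrite f0≡0 | f-odd 0 | f-even 0 | a0≡1 | g0≡1 = refl
  near _ (even (suc m)) rewrite f-odd (suc m) | f-even (suc m) | +-suc m m | f-even m | g0≡1 = begin
    a m ℤ.* g 2 ℤ.+ 0ℤ ℤ.+ a (suc m) ℤ.* 1ℤ
      ≡⟨ cong₂ ℤ._+_ (ℤ.+-identityʳ (a m ℤ.* g 2)) (ℤ.*-identityʳ (a (suc m))) ⟩
    a m ℤ.* g 2 ℤ.+ a (suc m)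
      ≡⟨ a-step m ⟩
    0ℤ ∎
    where open ≡-Reasoning
  near _ (odd m) rewrite f-odd m | f-even m | f-odd′ m | g1≡0 | ℤ.*-zeroʳ (a m) = refl
  coefficient : ∀ n → (f ⊛ g) n ≡ x² n
  coefficient zero          = cong (λ z → z ℤ.* g 0 ℤ.+ 0ℤ) f0≡0
  coefficient (suc zero)    = cong₂ (λ y z → y ℤ.* g 1 ℤ.+ (z ℤ.* g 0 ℤ.+ 0ℤ)) f0≡0 (f-odd 0)
  coefficient (suc (suc k)) = trans (⊛-quadratic f g g-vanish k) (near k (evenOrOdd k))

mainTheorem10 : ((n : ℕ) → (Gplus (0 ∷ 1 ∷ []) ⊛ oneMinusX²) n ≡ x² n)
                × ((n : ℕ) → (Gminus (0 ∷ 1 ∷ []) ⊛ onePlusX²) n ≡ x² n)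
mainTheorem10 =
    ⊛-even-series≡x² (Gplus π₁₂) oneMinusX² (λ _ → 1ℤ) refl refl (λ { (s≤s (s≤s (s≤s _))) → refl })
      (λ n n≢ → cong (ℤ.+_ ∘ length) (I₁₂-empty n n≢))
      (λ m → cong (ℤ.+_ ∘ length) (I₁₂-even m))
      refl (λ _ → refl)
  , ⊛-even-series≡x² (Gminus π₁₂) onePlusX² altSign refl refl (λ { (s≤s (s≤s (s≤s _))) → refl })
      (λ n n≢ → cong (sumℤ ∘ map sign) (I₁₂-empty n n≢))
      (λ m → trans (cong (sumℤ ∘ map sign) (I₁₂-even m)) (trans (ℤ.+-identityʳ _) (sign-oneAscent m)))
      refl (λ m → trans (cong (ℤ._+ - altSign m) (ℤ.*-identityʳ (altSign m))) (ℤ.+-inverseʳ (altSign m)))
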